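{- Let $p\in\mathbb{T}^{\mathcal{P}(n)}$ be a tropical Wick vector. Then every circuit of $p$ is tropically orthogonal to every cocircuit of $p$.
   Context: $[n]=\{1,\dots,n\}$, $\mathcal{P}(n)$ its power set, $\mathbb{T}=\mathbb{R}\cup\{\infty\}$. $p$ is a tropical Wick vector if for all $S,T\subseteq[n]$ the minimum $\min_{i\in S\Delta T}(p_{S\Delta\{i\}}+p_{T\Delta\{i\}})$ is attained at least twice or equals $\infty$. Let $\mathcal{J}=[n]\cup[n]^*$ with $[n]^*=\{1^*,\dots,n^*\}$ and involution $i\leftrightarrow i^*$. For $S\subseteq[n]$, $\bar S=S\cup([n]\setminus S)^*$; define $\bar p_{\bar S}=p_S$. For $T\subseteq[n]$ define $c_T,c^*_T\in\mathbb{T}^{\mathcal{J}}$ by $(c_T)_i=\bar p_{\bar T\Delta\{i,i^*\}}$ if $i\in\bar T$ and $\infty$ otherwise; $(c^*_T)_i=\bar p_{\bar T\Delta\{i,i^*\}}$ if $i\notin\bar T$ and $\infty$ otherwise. A circuit (resp. cocircuit) of $p$ is a vector $c_T+\lambda\mathbf{1}$ (resp. $c^*_T+\lambda\mathbf{1}$) with $T\subseteq[n]$, $\lambda\in\mathbb{R}$, having nonempty support. Vectors $x,y\in\mathbb{T}^N$ are tropically orthogonal if $\min_k(x_k+y_k)$ is attained at least twice or equals $\infty$. -}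

module Defs where

open import Data.Bool using (Bool; true; false; not; if_then_else_; _xor_)
open import Data.Nat using (ℕ)
open import Data.Fin using (Fin)
open import Data.Fin.Subset using (Subset)
open import Data.Vec using (lookup; updateAt)
open import Data.Sum using (_⊎_; inj₁; inj₂)
open import Data.Product using (Σ; _×_)
open import Relation.Binary.PropositionalEquality using (_≡_)
open import Relation.Nullary using (¬_)

-- The statement only uses
-- the additive group structure and the (total, translation-invariant) order of ℝ,
-- so we state it for an arbitrary totally ordered abelian group G (ℝ is one).
record OrderedAbGroup : Set₁ where
  infixl 6 _+_
  infix 4 _≤_
  field
    Carrier    : Set
    _+_        : Carrier → Carrier → Carrier
    0#         : Carrier
    -_         : Carrier → Carrier
    _≤_        : Carrier → Carrier → Set
    +-assoc    : ∀ x y z → (x + y) + z ≡ x + (y + z)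
    +-comm     : ∀ x y → x + y ≡ y + x
    +-identityʳ : ∀ x → x + 0# ≡ x
    +-inverseʳ : ∀ x → x + (- x) ≡ 0#
    ≤-refl     : ∀ {x} → x ≤ x
    ≤-trans    : ∀ {x y z} → x ≤ y → y ≤ z → x ≤ z
    ≤-antisym  : ∀ {x y} → x ≤ y → y ≤ x → x ≡ y
    ≤-total    : ∀ x y → (x ≤ y) ⊎ (y ≤ x)
    +-monoˡ-≤  : ∀ {x y} z → x ≤ y → x + z ≤ y + z

module Tropical (G : OrderedAbGroup) where
  open OrderedAbGroup G renaming (_+_ to _+G_; _≤_ to _≤G_)

  data 𝕋 : Set where
    fin : Carrier → 𝕋
    ∞   : 𝕋

  infixl 6 _⊙_
  _⊙_ : 𝕋 → 𝕋 → 𝕋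
  fin a ⊙ fin b = fin (a +G b)
  fin a ⊙ ∞     = ∞
  ∞     ⊙ _     = ∞

  infix 4 _≤𝕋_
  data _≤𝕋_ : 𝕋 → 𝕋 → Set where
    fin≤fin : ∀ {a b} → a ≤G b → fin a ≤𝕋 fin b
    ≤∞      : ∀ {x} → x ≤𝕋 ∞

  MinTwiceOrInf : {I : Set} → (I → 𝕋) → Set
  MinTwiceOrInf {I} x =
    (∀ k → x k ≡ ∞) ⊎
    Σ I λ k → Σ I λ l → ¬ (k ≡ l) × x k ≡ x l × (∀ m → x k ≤𝕋 x m)

  TropOrth : {I : Set} → (I → 𝕋) → (I → 𝕋) → Set
  TropOrth x y = MinTwiceOrInf (λ k → x k ⊙ y k)

  flip : ∀ {n} → Subset n → Fin n → Subset n
  flip S i = updateAt S i not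

  inΔ : ∀ {n} → Subset n → Subset n → Fin n → Bool
  inΔ S T i = lookup S i xor lookup T i

  IsWick : ∀ {n} → (Subset n → 𝕋) → Set
  IsWick {n} p = ∀ (S T : Subset n) →
    MinTwiceOrInf (λ (i : Fin n) →
      if inΔ S T i then p (flip S i) ⊙ p (flip T i) else ∞)

  -- 𝒥 = [n] ∪ [n]* : inj₁ i is i, inj₂ i is i*.
  𝒥 : ℕ → Set
  𝒥 n = Fin n ⊎ Fin n

  -- For T̄ = T ∪ ([n]∖T)*:  i ∈ T̄ iff i ∈ T,  i* ∈ T̄ iff i ∉ T,
  -- and T̄ Δ {i,i*} = \overline{T Δ {i}}, so p̄_{T̄Δ{i,i*}} = p_{TΔ{i}}.
  inBar : ∀ {n} → Subset n → 𝒥 n → Bool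
  inBar T (inj₁ i) = lookup T i
  inBar T (inj₂ i) = not (lookup T i)

  base : ∀ {n} → 𝒥 n → Fin n
  base (inj₁ i) = i
  base (inj₂ i) = i

  circ : ∀ {n} → (Subset n → 𝕋) → Subset n → 𝒥 n → 𝕋
  circ p T j = if inBar T j then p (flip T (base j)) else ∞

  cocirc : ∀ {n} → (Subset n → 𝕋) → Subset n → 𝒥 n → 𝕋
  cocirc p T j = if inBar T j then ∞ else p (flip T (base j))

  shift : ∀ {I : Set} → Carrier → (I → 𝕋) → I → 𝕋
  shift λ₀ x k = x k ⊙ fin λ₀

  HasNonemptySupport : {I : Set} → (I → 𝕋) → Set
  HasNonemptySupport {I} x = Σ I λ k → ¬ (x k ≡ ∞)

  IsCircuit : ∀ {n} → (Subset n → 𝕋) → (𝒥 n → 𝕋) → Set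
  IsCircuit {n} p x = Σ (Subset n) λ T → Σ Carrier λ λ₀ →
    (∀ j → x j ≡ shift λ₀ (circ p T) j) × HasNonemptySupport x

  IsCocircuit : ∀ {n} → (Subset n → 𝕋) → (𝒥 n → 𝕋) → Set
  IsCocircuit {n} p x = Σ (Subset n) λ T → Σ Carrier λ λ₀ →
    (∀ j → x j ≡ shift λ₀ (cocirc p T) j) × HasNonemptySupport x

-- For the circuit c_T and the cocircuit c*_U, the coordinate j ∈ {i, i*} of
-- c_T ⊙ c*_U is finite only if j lies in T̄ but not in Ū, and then it equals
-- p_{TΔ{i}} ⊙ p_{UΔ{i}}; such a j exists only for i ∈ T Δ U, and it is the copy
-- of i lying in T̄.  So the family (c_T ⊙ c*_U)_j is the Wick family of (T, U)
-- transported along an injection Fin n → 𝒥 and padded with ∞, and the Wick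
-- condition for (T, U) is exactly the orthogonality of c_T and c*_U.  Adding the
-- constants λ, μ of the circuit and cocircuit shifts every term by λ + μ, which
-- does not affect where the minimum is attained.
module Submission where

open import Defs
open import Data.Nat using (ℕ)
open import Data.Fin using (Fin)
open import Data.Fin.Subset using (Subset)
open import Data.Bool using (Bool; true; false; if_then_else_)
open import Data.Vec using (lookup)
open import Data.Sum using (_⊎_; inj₁; inj₂)
open import Data.Product using (Σ; _,_)
open import Function using (_∘_)
open import Function.Definitions using (Injective)
open import Relation.Binary.PropositionalEquality

module TropicalFacts (G : OrderedAbGroup) where
  open OrderedAbGroup G renaming (_+_ to _+G_; _≤_ to _≤G_)
  open Tropical G

  +-interchange : ∀ a b c d → (a +G c) +G (b +G d) ≡ (a +G b) +G (c +G d)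
  +-interchange a b c d = begin
    (a +G c) +G (b +G d)  ≡⟨ +-assoc a c (b +G d) ⟩
    a +G (c +G (b +G d))  ≡⟨ cong (a +G_) (sym (+-assoc c b d)) ⟩
    a +G ((c +G b) +G d)  ≡⟨ cong (λ e → a +G (e +G d)) (+-comm c b) ⟩
    a +G ((b +G c) +G d)  ≡⟨ cong (a +G_) (+-assoc b c d) ⟩
    a +G (b +G (c +G d))  ≡⟨ sym (+-assoc a b (c +G d)) ⟩
    (a +G b) +G (c +G d)  ∎
    where open ≡-Reasoning

  ⊙-zeroʳ : ∀ a → a ⊙ ∞ ≡ ∞
  ⊙-zeroʳ (fin a) = refl
  ⊙-zeroʳ ∞       = refl

  ⊙-monoˡ-≤ : ∀ {a b} c → a ≤𝕋 b → a ⊙ c ≤𝕋 b ⊙ c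
  ⊙-monoˡ-≤ (fin c) (fin≤fin a≤b) = fin≤fin (+-monoˡ-≤ c a≤b)
  ⊙-monoˡ-≤ ∞       (fin≤fin _)   = ≤∞
  ⊙-monoˡ-≤ (fin c) ≤∞            = ≤∞
  ⊙-monoˡ-≤ ∞       ≤∞            = ≤∞

  shift-⊙-shift : ∀ l m a b → (a ⊙ fin l) ⊙ (b ⊙ fin m) ≡ (a ⊙ b) ⊙ fin (l +G m)
  shift-⊙-shift l m (fin a) (fin b) = cong fin (+-interchange a b l m)
  shift-⊙-shift l m (fin a) ∞       = refl
  shift-⊙-shift l m ∞       b       = refl

  minTwiceOrInf-resp : {I : Set} {x y : I → 𝕋} →
    (∀ k → x k ≡ y k) → MinTwiceOrInf x → MinTwiceOrInf y
  minTwiceOrInf-resp x≡y (inj₁ all∞) = inj₁ λ k → trans (sym (x≡y k)) (all∞ k)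
  minTwiceOrInf-resp x≡y (inj₂ (k , l , k≢l , xk≡xl , xk-min)) =
    inj₂ (k , l , k≢l , trans (sym (x≡y k)) (trans xk≡xl (x≡y l))
         , λ m → subst₂ _≤𝕋_ (x≡y k) (x≡y m) (xk-min m))

  minTwiceOrInf-⊙ : {I : Set} {x : I → 𝕋} (c : 𝕋) →
    MinTwiceOrInf x → MinTwiceOrInf (λ k → x k ⊙ c)
  minTwiceOrInf-⊙ c (inj₁ all∞) = inj₁ λ k → cong (_⊙ c) (all∞ k)
  minTwiceOrInf-⊙ c (inj₂ (k , l , k≢l , xk≡xl , xk-min)) =
    inj₂ (k , l , k≢l , cong (_⊙ c) xk≡xl , λ m → ⊙-monoˡ-≤ c (xk-min m))

  minTwiceOrInf-embed : {I J : Set} {x : I → 𝕋} {y : J → 𝕋} (f : I → J) →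
    Injective _≡_ _≡_ f → (∀ i → y (f i) ≡ x i) →
    (∀ j → y j ≡ ∞ ⊎ Σ I λ i → j ≡ f i) →
    MinTwiceOrInf x → MinTwiceOrInf y
  minTwiceOrInf-embed {I} {x = x} {y} f f-inj y∘f≡x ∞-off-image (inj₁ all∞) =
    inj₁ λ j → is-∞ (∞-off-image j)
    where
    is-∞ : ∀ {j} → y j ≡ ∞ ⊎ Σ I (λ i → j ≡ f i) → y j ≡ ∞
    is-∞ (inj₁ yj≡∞)       = yj≡∞
    is-∞ (inj₂ (i , refl)) = trans (y∘f≡x i) (all∞ i)
  minTwiceOrInf-embed {I} {x = x} {y} f f-inj y∘f≡x ∞-off-image
                      (inj₂ (k , l , k≢l , xk≡xl , xk-min)) =
    inj₂ (f k , f l , k≢l ∘ f-inj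
         , trans (y∘f≡x k) (trans xk≡xl (sym (y∘f≡x l)))
         , λ j → above-min (∞-off-image j))
    where
    above-min : ∀ {j} → y j ≡ ∞ ⊎ Σ I (λ i → j ≡ f i) → y (f k) ≤𝕋 y j
    above-min (inj₁ yj≡∞)       = subst (y (f k) ≤𝕋_) (sym yj≡∞) ≤∞
    above-min (inj₂ (i , refl)) = subst₂ _≤𝕋_ (sym (y∘f≡x k)) (sym (y∘f≡x i)) (xk-min i)

  module _ {n : ℕ} (p : Subset n → 𝕋) (T U : Subset n) where

    wickTerm : Fin n → 𝕋
    wickTerm i = if inΔ T U i then p (flip T i) ⊙ p (flip U i) else ∞

    circ⊙cocirc : 𝒥 n → 𝕋
    circ⊙cocirc j = circ p T j ⊙ cocirc p U j

    copyOf : Bool → Fin n → 𝒥 n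
    copyOf true  i = inj₁ i
    copyOf false i = inj₂ i

    copyInBar : Fin n → 𝒥 n
    copyInBar i = copyOf (lookup T i) i

    base-copyOf : ∀ b i → base (copyOf b i) ≡ i
    base-copyOf true  i = refl
    base-copyOf false i = refl

    copyInBar-injective : Injective _≡_ _≡_ copyInBar
    copyInBar-injective {i} {i′} eq =
      trans (sym (base-copyOf (lookup T i) i))
            (trans (cong base eq) (base-copyOf (lookup T i′) i′))

    -- The bits of T and U at i are taken as equations so that rewrite also
    -- reaches their occurrences inside wickTerm and copyInBar.
    circ⊙cocirc-copyOf : ∀ i {b c} → lookup T i ≡ b → lookup U i ≡ c →
                         circ⊙cocirc (copyOf b i) ≡ wickTerm i
    circ⊙cocirc-copyOf i {true}  {true}  T-i U-i rewrite T-i | U-i = ⊙-zeroʳ (p (flip T i))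
    circ⊙cocirc-copyOf i {true}  {false} T-i U-i rewrite T-i | U-i = refl
    circ⊙cocirc-copyOf i {false} {true}  T-i U-i rewrite T-i | U-i = refl
    circ⊙cocirc-copyOf i {false} {false} T-i U-i rewrite T-i | U-i = ⊙-zeroʳ (p (flip T i))

    circ⊙cocirc-∞-off-copy : ∀ j {b c} → lookup T (base j) ≡ b → lookup U (base j) ≡ c →
                             circ⊙cocirc j ≡ ∞ ⊎ Σ (Fin n) λ i → j ≡ copyInBar i
    circ⊙cocirc-∞-off-copy (inj₁ i) {true}  {true}  T-i U-i rewrite T-i | U-i = inj₁ (⊙-zeroʳ (p (flip T i)))
    circ⊙cocirc-∞-off-copy (inj₁ i) {true}  {false} T-i U-i rewrite T-i | U-i = inj₂ (i , cong (λ b → copyOf b i) (sym T-i))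
    circ⊙cocirc-∞-off-copy (inj₁ i) {false}         T-i U-i rewrite T-i       = inj₁ refl
    circ⊙cocirc-∞-off-copy (inj₂ i) {true}          T-i U-i rewrite T-i       = inj₁ refl
    circ⊙cocirc-∞-off-copy (inj₂ i) {false} {true}  T-i U-i rewrite T-i | U-i = inj₂ (i , cong (λ b → copyOf b i) (sym T-i))
    circ⊙cocirc-∞-off-copy (inj₂ i) {false} {false} T-i U-i rewrite T-i | U-i = inj₁ (⊙-zeroʳ (p (flip T i)))

    circ-orth-cocirc : MinTwiceOrInf wickTerm → TropOrth (circ p T) (cocirc p U)
    circ-orth-cocirc = minTwiceOrInf-embed copyInBar copyInBar-injective
      (λ i → circ⊙cocirc-copyOf i refl refl) (λ j → circ⊙cocirc-∞-off-copy j refl refl)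

mainTheorem7 : (G : OrderedAbGroup) → let open Tropical G in
    (n : ℕ) (p : Subset n → 𝕋) → IsWick p →
    (x y : 𝒥 n → 𝕋) → IsCircuit p x → IsCocircuit p y → TropOrth x y
mainTheorem7 G n p wick x y (T , λ₀ , x≡ , _) (U , μ₀ , y≡ , _) =
  minTwiceOrInf-resp shifted-product
    (minTwiceOrInf-⊙ (fin (λ₀ + μ₀)) (circ-orth-cocirc p T U (wick T U)))
  where
  open OrderedAbGroup G using (_+_)
  open Tropical G
  open TropicalFacts G

  shifted-product : ∀ j → circ p T j ⊙ cocirc p U j ⊙ fin (λ₀ + μ₀) ≡ x j ⊙ y j
  shifted-product j =
    sym (trans (cong₂ _⊙_ (x≡ j) (y≡ j)) (shift-⊙-shift λ₀ μ₀ (circ p T j) (cocirc p U j)))
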